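{- Let $n\ge 2$ and $r\ge 1$ be integers such that $r<4n$ and $\frac{r(r-1)}{2}\equiv n+1 \pmod{2n}$, and let \[f_{n,r}(t)=8n^2t^2+2n(2r-1)t+\left(\frac{r(r-1)}{2}-n\right)\in\mathbb{Z}[t].\] Suppose $f_{n,r}$ is reducible in $\mathbb{Z}[t]$, so that $n=a(a+1)/2$ for a (unique) positive integer $a$. Let $p$ be a prime and $e\ge 1$ an integer. Then $f_{n,r}(0)=p^e$ if and only if $p$ is odd and one of the following holds: (a) $e=2i$ is even, with $n=(p^e-1)/8>1$, $a=(p^i-1)/2$ and $r=(3p^i+1)/2$; or (b) $p^e=7$, with $n=3$, $a=2$ and $r=5$. -}

module Defs where

open import Data.Nat as ℕ using (ℕ)
open import Data.Nat.DivMod using (_/_)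
open import Data.Integer as ℤ using (ℤ; +_; _-_; _*_; 1ℤ; 0ℤ; _+_)
open import Data.Integer.Divisibility using (_∣_)
open import Data.Product using (Σ; _×_; ∃-syntax)
open import Data.Sum using (_⊎_)
open import Relation.Binary.PropositionalEquality using (_≡_; _≢_)

-- triangular-type number r(r-1)/2 (exact: r(r-1) is even)
T : ℕ → ℕ
T r = (r ℕ.* (r ℕ.∸ 1)) / 2

fA : ℕ → ℤ
fA n = + (8 ℕ.* n ℕ.* n)

fB : ℕ → ℕ → ℤ
fB n r = + (2 ℕ.* n) * (+ (2 ℕ.* r) - 1ℤ)

fC : ℕ → ℕ → ℤ
fC n r = + T r - + n

-- By degree, either one factor is a
-- constant d with |d| > 1 (d divides all coefficients), or both factors
-- are of degree 1: (α t + β)(γ t + δ) with α, γ ≠ 0.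
ReducibleQuad : ℤ → ℤ → ℤ → Set
ReducibleQuad A B C =
  (∃[ d ] (1 ℕ.< ℤ.∣ d ∣ × (d ∣ A) × (d ∣ B) × (d ∣ C)))
  ⊎ (∃[ α ] ∃[ β ] ∃[ γ ] ∃[ δ ]
       (α ≢ 0ℤ × γ ≢ 0ℤ × α * γ ≡ A × α * δ + β * γ ≡ B × β * δ ≡ C))

Reducible-f : ℕ → ℕ → Set
Reducible-f n r = ReducibleQuad (fA n) (fB n r) (fC n r)

-- Put 2n = a(a + 1) and r = a + 1 + x. As r(r − 1) = a(a + 1) + x(x + 2a + 1), the equation f(0) = p^e
-- reads x(x + 2a + 1) = 2p^e, and the congruence hypothesis says a(a + 1) ∣ p^e − 1, which already makes
-- p odd. The two factors have opposite parity, so one is p^j and the other 2p^k. Equal exponents give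
-- x = 2a + 1 = p^j, case (a); x = 2 gives p^e = 2a + 3, and a(a + 1) ∣ 2(a + 1) forces a = 2, case (b).
-- In every other configuration a further power of p splits off, and (2a + 1)² = 4a(a + 1) + 1 shows that
-- a(a + 1) cannot divide p^e − 1.
module Submission where

open import Defs
open import Data.Nat
  using (ℕ; zero; suc; pred; _≤_; _<_; _+_; _*_; _^_; _%_; z≤n; s≤s; z<s; NonZero; ≢-nonZero; nonTrivial⇒n>1)
open import Data.Nat.Properties
open import Data.Nat.DivMod using (m/n*n≡m; [m+kn]%n≡m%n)
open import Data.Nat.Divisibility as ℕ using (divides; ∣⇒≤; >⇒∤; ∣m+n∣m⇒∣n; *-cancelʳ-∣; ∣-trans; n∣m*n)
open import Data.Nat.Primality using (Prime; euclidsLemma; prime⇒nonZero; prime⇒nonTrivial)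
open import Data.Nat.Tactic.RingSolver using (solve-∀)
open import Data.Integer using (+_; _-_; _⊖_; ∣_∣)
open import Data.Integer.Divisibility using (_∣_)
open import Data.Integer.Properties using ([+m]-[+n]≡m⊖n; [1+m]⊖[1+n]≡m⊖n; +-cancelˡ-⊖; ⊖-≥)
open import Data.Product using (_×_; _,_; proj₂; ∃-syntax)
open import Data.Sum using (_⊎_; inj₁; inj₂)
open import Function using (_∘_)
open import Function.Bundles using (_⇔_; mk⇔)
open import Relation.Binary.PropositionalEquality
  using (_≡_; _≢_; refl; sym; trans; cong; subst; subst₂; module ≡-Reasoning)
open import Relation.Binary.Definitions using (tri<; tri≈; tri>)
open import Relation.Nullary.Negation using (¬_; contradiction)

data Parity : ℕ → Set where
  even : ∀ h → Parity (h * 2)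
  odd  : ∀ h → Parity (suc (h * 2))

parity : ∀ n → Parity n
parity zero = even 0
parity (suc n) with parity n
... | even h = odd h
... | odd h = even (suc h)

m*2≢1+n*2 : ∀ m n → m * 2 ≢ suc (n * 2)
m*2≢1+n*2 (suc m) (suc n) eq = m*2≢1+n*2 m n (suc-injective (suc-injective eq))

2∣[1+n]*n : ∀ n → 2 ℕ.∣ suc n * n
2∣[1+n]*n n with parity n
... | even h = divides (suc n * h) (sym (*-assoc (suc n) h 2))
... | odd h = divides (suc h * n) (shuffle (suc h) n)
  where shuffle : ∀ u v → u * 2 * v ≡ u * v * 2
        shuffle = solve-∀

[1+a]*a≡a*[a+1] : ∀ a → suc a * a ≡ a * (a + 1)
[1+a]*a≡a*[a+1] a = trans (*-comm (suc a) a) (cong (_*_ a) (+-comm 1 a))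

2∣a*[a+1] : ∀ a → 2 ℕ.∣ a * (a + 1)
2∣a*[a+1] a = subst (2 ℕ.∣_) ([1+a]*a≡a*[a+1] a) (2∣[1+n]*n a)

T[1+m]*2≡[1+m]*m : ∀ m → T (suc m) * 2 ≡ suc m * m
T[1+m]*2≡[1+m]*m m = m/n*n≡m (2∣[1+n]*n m)

[2a+1]²≡1+4a[a+1] : ∀ a → (2 * a + 1) * (2 * a + 1) ≡ suc (4 * (a * (a + 1)))
[2a+1]²≡1+4a[a+1] = solve-∀

0<2a+1 : ∀ a → 0 < 2 * a + 1
0<2a+1 a = subst (0 <_) (+-comm 1 (2 * a)) z<s

∣∧<⇒≡0 : ∀ {d n} → d ℕ.∣ n → n < d → n ≡ 0
∣∧<⇒≡0 {n = zero} _ _ = refl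
∣∧<⇒≡0 {n = suc _} d∣n n<d = contradiction d∣n (>⇒∤ n<d)

^≡1+even⇒odd : ∀ p e D → 2 ℕ.∣ D → p ^ suc e ≡ suc D → p % 2 ≡ 1
^≡1+even⇒odd p e D (divides q refl) p^e≡ with parity p
... | even h = contradiction (trans (sym (shuffle h (p ^ e))) p^e≡) (m*2≢1+n*2 (h * p ^ e) q)
  where shuffle : ∀ u v → u * 2 * v ≡ u * v * 2
        shuffle = solve-∀
... | odd h = [m+kn]%n≡m%n 1 h 2

2*n≡a*[a+1]⇒2≤a : ∀ n a → 2 ≤ n → 2 * n ≡ a * (a + 1) → 2 ≤ a
2*n≡a*[a+1]⇒2≤a (suc (suc n)) zero _ ()
2*n≡a*[a+1]⇒2≤a n (suc zero) 2≤n eq with *-cancelˡ-≡ n 1 2 eq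
2*n≡a*[a+1]⇒2≤a .1 (suc zero) (s≤s ()) eq | refl
2*n≡a*[a+1]⇒2≤a _ (suc (suc a)) _ _ = s≤s (s≤s z≤n)

-- When 2a + 1 = A(2P − 1) with P ≥ 2, already 4a(a + 1) + 1 ≥ 4A²P + A², so 0 < A²P − 1 < a(a + 1).
a[a+1]∤-odd-split : ∀ a A P D → 2 ≤ P → A + (2 * a + 1) ≡ 2 * (A * P) → suc D ≡ A * (A * P)
                  → ¬ (a * (a + 1) ℕ.∣ D)
a[a+1]∤-odd-split a zero P D _ split _ _ = m+1+n≢0 (2 * a) split
a[a+1]∤-odd-split a A@(suc A-1) P D 2≤P split 1+D≡ a[a+1]∣D with m≤n⇒∃[o]m+o≡n 2≤P
... | Q , refl = D≢0 (∣∧<⇒≡0 a[a+1]∣D D<a[a+1])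
  where
  R : ℕ
  R = A-1 * (2 + A-1) + A * A * (8 * Q + 4 * Q * Q)
  2a+1≡ : 2 * a + 1 ≡ A * (3 + 2 * Q)
  2a+1≡ = +-cancelˡ-≡ A _ _ (trans split (expand A Q))
    where expand : ∀ A Q → 2 * (A * (2 + Q)) ≡ A + A * (3 + 2 * Q)
          expand = solve-∀
  4a[a+1]≡ : 4 * (a * (a + 1)) ≡ 4 * suc D + R
  4a[a+1]≡ = suc-injective (begin
    suc (4 * (a * (a + 1)))             ≡⟨ sym ([2a+1]²≡1+4a[a+1] a) ⟩
    (2 * a + 1) * (2 * a + 1)           ≡⟨ cong (λ z → z * z) 2a+1≡ ⟩
    A * (3 + 2 * Q) * (A * (3 + 2 * Q)) ≡⟨ expand A-1 Q ⟩
    suc (4 * (A * (A * (2 + Q))) + R)   ≡⟨ cong (λ z → suc (4 * z + R)) (sym 1+D≡) ⟩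
    suc (4 * suc D + R)                 ∎)
    where
    open ≡-Reasoning
    expand : ∀ A-1 Q → suc A-1 * (3 + 2 * Q) * (suc A-1 * (3 + 2 * Q))
                     ≡ suc (4 * (suc A-1 * (suc A-1 * (2 + Q)))
                            + (A-1 * (2 + A-1) + suc A-1 * suc A-1 * (8 * Q + 4 * Q * Q)))
    expand = solve-∀
  D<a[a+1] : D < a * (a + 1)
  D<a[a+1] = *-cancelˡ-≤ 4 (≤-trans (m≤m+n (4 * suc D) R) (≤-reflexive (sym 4a[a+1]≡)))
  D≢0 : D ≢ 0
  D≢0 D≡0 with m*n≡1⇒n≡1 A (2 + Q) (m*n≡1⇒n≡1 A (A * (2 + Q)) (sym (subst (λ d → suc d ≡ _) D≡0 1+D≡)))
  ... | ()

2<d⇒d∤k*d+2 : ∀ {d} k → 2 < d → ¬ (d ℕ.∣ k * d + 2)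
2<d⇒d∤k*d+2 k 2<d d∣k*d+2 = contradiction (∣⇒≤ (∣m+n∣m⇒∣n d∣k*d+2 (n∣m*n k))) (<⇒≱ 2<d)

-- With m = 3 + t = P − 2: multiplying A²P ≡ 1 (mod a(a + 1)) by m² and using A²m² = 4a(a + 1) + 1
-- gives m² ≡ P, i.e. a(a + 1) ∣ (P − 1)(P − 4), which is positive and smaller than a(a + 1).
a[a+1]∤-even-split-≥5 : ∀ a A t D → 2 ≤ A → 2 * a + 1 ≡ A * (3 + t) → suc D ≡ A * (A * (5 + t))
                      → ¬ (a * (a + 1) ℕ.∣ D)
a[a+1]∤-even-split-≥5 a A@(suc (suc A-2)) t D (s≤s (s≤s z≤n)) 2a+1≡ 1+D≡ a[a+1]∣D = >⇒∤ N<a[a+1] a[a+1]∣N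
  where
  N : ℕ
  N = (1 + t) * (4 + t)
  m²D+N≡ : (3 + t) * (3 + t) * D + N ≡ 4 * (5 + t) * (a * (a + 1))
  m²D+N≡ = +-cancelʳ-≡ (5 + t) _ _ (begin
    (3 + t) * (3 + t) * D + N + (5 + t)       ≡⟨ expand₁ t D ⟩
    (3 + t) * (3 + t) * suc D                 ≡⟨ cong ((3 + t) * (3 + t) *_) 1+D≡ ⟩
    (3 + t) * (3 + t) * (A * (A * (5 + t)))   ≡⟨ expand₂ A t ⟩
    A * (3 + t) * (A * (3 + t)) * (5 + t)     ≡⟨ cong (λ z → z * z * (5 + t)) (sym 2a+1≡) ⟩
    (2 * a + 1) * (2 * a + 1) * (5 + t)       ≡⟨ cong (_* (5 + t)) ([2a+1]²≡1+4a[a+1] a) ⟩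
    suc (4 * (a * (a + 1))) * (5 + t)         ≡⟨ expand₃ (a * (a + 1)) t ⟩
    4 * (5 + t) * (a * (a + 1)) + (5 + t)     ∎)
    where
    open ≡-Reasoning
    expand₁ : ∀ t D → (3 + t) * (3 + t) * D + (1 + t) * (4 + t) + (5 + t) ≡ (3 + t) * (3 + t) * suc D
    expand₁ = solve-∀
    expand₂ : ∀ A t → (3 + t) * (3 + t) * (A * (A * (5 + t))) ≡ A * (3 + t) * (A * (3 + t)) * (5 + t)
    expand₂ = solve-∀
    expand₃ : ∀ E t → suc (4 * E) * (5 + t) ≡ 4 * (5 + t) * E + (5 + t)
    expand₃ = solve-∀
  a[a+1]∣N : a * (a + 1) ℕ.∣ N
  a[a+1]∣N = ∣m+n∣m⇒∣n (subst (a * (a + 1) ℕ.∣_) (sym m²D+N≡) (n∣m*n (4 * (5 + t))))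
                  (∣-trans a[a+1]∣D (n∣m*n ((3 + t) * (3 + t))))
  V : ℕ
  V = 4 * t + 15 + (A-2 * A-2 + 4 * A-2) * (3 + t) * (3 + t)
  N<a[a+1] : N < a * (a + 1)
  N<a[a+1] = *-cancelˡ-≤ 4 (≤-trans (m≤m+n (4 * suc N) V) (≤-reflexive (sym (suc-injective 1+4a[a+1]≡))))
    where
    expand : ∀ A-2 t → suc (suc A-2) * (3 + t) * (suc (suc A-2) * (3 + t))
                     ≡ suc (4 * suc ((1 + t) * (4 + t))
                            + (4 * t + 15 + (A-2 * A-2 + 4 * A-2) * (3 + t) * (3 + t)))
    expand = solve-∀
    1+4a[a+1]≡ : suc (4 * (a * (a + 1))) ≡ suc (4 * suc N + V)
    1+4a[a+1]≡ = trans (sym ([2a+1]²≡1+4a[a+1] a)) (trans (cong (λ z → z * z) 2a+1≡) (expand A-2 t))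

-- Here 2a + 1 = A(P − 2); P = 3 leaves a(a + 1) ∣ 2 and P = 4 makes 2a + 1 even.
a[a+1]∤-even-split : ∀ a A P D → 2 ≤ a → 2 ≤ A → 2 * A + (2 * a + 1) ≡ A * P → suc D ≡ A * (A * P)
                   → ¬ (a * (a + 1) ℕ.∣ D)
a[a+1]∤-even-split a A P D 2≤a 2≤A split with m≤n⇒∃[o]m+o≡n 3≤P
  where
  3≤P : 3 ≤ P
  3≤P = *-cancelˡ-< A 2 P
          (subst (_< A * P) (*-comm 2 A) (subst (2 * A <_) split (m<m+n (2 * A) (0<2a+1 a))))
... | o , refl = excluded o (+-cancelˡ-≡ (2 * A) _ _ (trans split (expand A o)))
  where
  expand : ∀ A o → A * (3 + o) ≡ 2 * A + A * (1 + o)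
  expand = solve-∀
  excluded : ∀ o → 2 * a + 1 ≡ A * (1 + o) → suc D ≡ A * (A * (3 + o)) → ¬ (a * (a + 1) ℕ.∣ D)
  excluded zero 2a+1≡A 1+D≡ = 2<d⇒d∤k*d+2 12 2<a[a+1] ∘ subst (a * (a + 1) ℕ.∣_) D≡
    where
    2<a[a+1] : 2 < a * (a + 1)
    2<a[a+1] = ≤-trans (s≤s (s≤s (s≤s z≤n))) (*-mono-≤ 2≤a (+-monoˡ-≤ 1 2≤a))
    D≡ : D ≡ 12 * (a * (a + 1)) + 2
    D≡ = suc-injective (trans 1+D≡
           (trans (cong (λ z → z * (z * 3)) (sym (trans 2a+1≡A (*-identityʳ A)))) (expand′ a)))
      where expand′ : ∀ a → (2 * a + 1) * ((2 * a + 1) * 3) ≡ suc (12 * (a * (a + 1)) + 2)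
            expand′ = solve-∀
  excluded (suc zero) 2a+1≡2A _ _ =
    m*2≢1+n*2 A a (trans (sym 2a+1≡2A) (trans (+-comm (2 * a) 1) (cong suc (*-comm 2 a))))
  excluded (suc (suc t)) = a[a+1]∤-even-split-≥5 a A t D 2≤A

module _ {p : ℕ} (p-prime : Prime p) where

  private instance
    p≢0 : NonZero p
    p≢0 = prime⇒nonZero p-prime

  factors-of-prime-power : ∀ e u v → u * v ≡ p ^ e →
                           ∃[ j ] ∃[ k ] (u ≡ p ^ j × v ≡ p ^ k × j + k ≡ e)
  factors-of-prime-power zero u v uv≡1 = 0 , 0 , m*n≡1⇒m≡1 u v uv≡1 , m*n≡1⇒n≡1 u v uv≡1 , refl
  factors-of-prime-power (suc e) u v uv≡
    with euclidsLemma u v p-prime (divides (p ^ e) (trans uv≡ (*-comm p (p ^ e))))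
  ... | inj₁ (divides q refl)
    with factors-of-prime-power e q v (*-cancelˡ-≡ (q * v) (p ^ e) p (trans (shuffle p q v) uv≡))
    where shuffle : ∀ p q v → p * (q * v) ≡ q * p * v
          shuffle = solve-∀
  ...   | j , k , q≡ , v≡ , j+k≡e =
    suc j , k , trans (cong (_* p) q≡) (*-comm (p ^ j) p) , v≡ , cong suc j+k≡e
  factors-of-prime-power (suc e) u v uv≡ | inj₂ (divides q refl)
    with factors-of-prime-power e u q (*-cancelˡ-≡ (u * q) (p ^ e) p (trans (shuffle p u q) uv≡))
    where shuffle : ∀ p u q → p * (u * q) ≡ u * (q * p)
          shuffle = solve-∀
  ...   | j , k , u≡ , q≡ , j+k≡e =
    j , suc k , u≡ , trans (cong (_* p) q≡) (*-comm (p ^ k) p) , trans (+-suc j k) (cong suc j+k≡e)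

  p^suc≥2 : ∀ o → 2 ≤ p ^ suc o
  p^suc≥2 o = ^-monoʳ-< p (nonTrivial⇒n>1 p {{prime⇒nonTrivial p-prime}}) {0} {suc o} z<s

  p^[1+j+o]≡p^j*p^[1+o] : ∀ j o → p ^ (suc j + o) ≡ p ^ j * p ^ suc o
  p^[1+j+o]≡p^j*p^[1+o] j o = trans (cong (p ^_) (sym (+-suc j o))) (^-distribˡ-+-* p j (suc o))

  odd-exponents : ∀ a j k D → p ^ j + (2 * a + 1) ≡ 2 * p ^ k → p ^ (j + k) ≡ suc D → a * (a + 1) ℕ.∣ D
                → j ≡ k × 2 * a + 1 ≡ p ^ j
  odd-exponents a j k D rel p^e≡1+D a[a+1]∣D with <-cmp j k
  ... | tri≈ _ refl _ =
    refl , +-cancelˡ-≡ (p ^ j) _ _ (trans rel (cong (_+_ (p ^ j)) (+-identityʳ (p ^ j))))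
  ... | tri< j<k _ _ with m≤n⇒∃[o]m+o≡n j<k
  ...   | o , refl =
    contradiction a[a+1]∣D (a[a+1]∤-odd-split a (p ^ j) (p ^ suc o) D (p^suc≥2 o) split 1+D≡)
    where
    split : p ^ j + (2 * a + 1) ≡ 2 * (p ^ j * p ^ suc o)
    split = trans rel (cong (2 *_) (p^[1+j+o]≡p^j*p^[1+o] j o))
    1+D≡ : suc D ≡ p ^ j * (p ^ j * p ^ suc o)
    1+D≡ = trans (sym p^e≡1+D)
             (trans (^-distribˡ-+-* p j (suc j + o)) (cong ((p ^ j) *_) (p^[1+j+o]≡p^j*p^[1+o] j o)))
  odd-exponents a j k D rel p^e≡1+D a[a+1]∣D | tri> _ _ k<j with m≤n⇒∃[o]m+o≡n k<j
  ...   | o , refl = contradiction (sym rel) (<⇒≢ 2p^k<p^j+2a+1)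
    where
    2p^k<p^j+2a+1 : 2 * p ^ k < p ^ (suc k + o) + (2 * a + 1)
    2p^k<p^j+2a+1 = begin-strict
      2 * p ^ k                          ≡⟨ *-comm 2 (p ^ k) ⟩
      p ^ k * 2                          ≤⟨ *-monoʳ-≤ (p ^ k) (p^suc≥2 o) ⟩
      p ^ k * p ^ suc o                  ≡⟨ sym (p^[1+j+o]≡p^j*p^[1+o] k o) ⟩
      p ^ (suc k + o)                    <⟨ m<m+n (p ^ (suc k + o)) (0<2a+1 a) ⟩
      p ^ (suc k + o) + (2 * a + 1)      ∎
      where open ≤-Reasoning

  even-exponents : ∀ a j k D → 2 ≤ a → p ^ j * 2 + (2 * a + 1) ≡ p ^ k → p ^ (j + k) ≡ suc D
                 → a * (a + 1) ℕ.∣ D → j ≡ 0 × a ≡ 2 × p ^ k ≡ 7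
  even-exponents a zero k D 2≤a rel p^e≡1+D a[a+1]∣D =
    refl , a≡2 , trans (sym rel) (cong (λ a → 2 + (2 * a + 1)) a≡2)
    where
    instance
      a+1≢0 : NonZero (a + 1)
      a+1≢0 = ≢-nonZero (m+1+n≢0 a)
    D≡ : D ≡ 2 * (a + 1)
    D≡ = suc-injective (trans (sym p^e≡1+D) (trans (sym rel) (expand a)))
      where expand : ∀ a → 2 + (2 * a + 1) ≡ suc (2 * (a + 1))
            expand = solve-∀
    a≡2 : a ≡ 2
    a≡2 = ≤-antisym (∣⇒≤ (*-cancelʳ-∣ (a + 1) (subst (a * (a + 1) ℕ.∣_) D≡ a[a+1]∣D))) 2≤a
  even-exponents a (suc j) k D 2≤a rel p^e≡1+D a[a+1]∣D with ≤-total (suc j) k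
  ... | inj₁ j≤k with m≤n⇒∃[o]m+o≡n j≤k
  ...   | o , refl =
    contradiction a[a+1]∣D (a[a+1]∤-even-split a A (p ^ o) D 2≤a (p^suc≥2 j) split 1+D≡)
    where
    A = p ^ suc j
    split : 2 * A + (2 * a + 1) ≡ A * p ^ o
    split = trans (cong (_+ (2 * a + 1)) (*-comm 2 A)) (trans rel (^-distribˡ-+-* p (suc j) o))
    1+D≡ : suc D ≡ A * (A * p ^ o)
    1+D≡ = trans (sym p^e≡1+D)
             (trans (^-distribˡ-+-* p (suc j) (suc j + o)) (cong (A *_) (^-distribˡ-+-* p (suc j) o)))
  even-exponents a (suc j) k D 2≤a rel p^e≡1+D a[a+1]∣D | inj₂ k≤j =
    contradiction (sym rel) (<⇒≢ p^k<2p^j+2a+1)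
    where
    p^k<2p^j+2a+1 : p ^ k < p ^ suc j * 2 + (2 * a + 1)
    p^k<2p^j+2a+1 = begin-strict
      p ^ k                              ≤⟨ ^-monoʳ-≤ p k≤j ⟩
      p ^ suc j                          ≤⟨ m≤m*n (p ^ suc j) 2 ⟩
      p ^ suc j * 2                      <⟨ m<m+n (p ^ suc j * 2) (0<2a+1 a) ⟩
      p ^ suc j * 2 + (2 * a + 1)        ∎
      where open ≤-Reasoning

  solutions-of-x[x+2a+1]≡2p^e : ∀ a e x D → 2 ≤ a → x * (x + (2 * a + 1)) ≡ 2 * p ^ e → p ^ e ≡ suc D
    → a * (a + 1) ℕ.∣ D → (∃[ i ] (e ≡ 2 * i × 2 * a + 1 ≡ p ^ i × x ≡ p ^ i)) ⊎ (a ≡ 2 × x ≡ 2 × p ^ e ≡ 7)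
  solutions-of-x[x+2a+1]≡2p^e a e x D 2≤a eq p^e≡1+D a[a+1]∣D with parity x
  ... | even h with factors-of-prime-power e h _ (*-cancelˡ-≡ _ _ 2 (trans (halve h a) eq))
    where halve : ∀ h a → 2 * (h * (h * 2 + (2 * a + 1))) ≡ h * 2 * (h * 2 + (2 * a + 1))
          halve = solve-∀
  ...   | j , k , refl , rel , refl with even-exponents a j k D 2≤a rel p^e≡1+D a[a+1]∣D
  ...     | refl , a≡2 , p^k≡7 = inj₂ (a≡2 , refl , p^k≡7)
  solutions-of-x[x+2a+1]≡2p^e a e x D 2≤a eq p^e≡1+D a[a+1]∣D | odd h
    with factors-of-prime-power e (suc (h * 2)) (h + a + 1) (*-cancelˡ-≡ _ _ 2 (trans (halve h a) eq))
    where halve : ∀ h a → 2 * (suc (h * 2) * (h + a + 1)) ≡ suc (h * 2) * (suc (h * 2) + (2 * a + 1))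
          halve = solve-∀
  ...   | j , k , x≡ , y≡ , refl with odd-exponents a j k D rel p^e≡1+D a[a+1]∣D
    where rel : p ^ j + (2 * a + 1) ≡ 2 * p ^ k
          rel = trans (cong (_+ (2 * a + 1)) (sym x≡)) (trans (expand h a) (cong (2 *_) y≡))
            where expand : ∀ h a → suc (h * 2) + (2 * a + 1) ≡ 2 * (h + a + 1)
                  expand = solve-∀
  ...     | refl , 2a+1≡ = inj₁ (j , cong (_+_ j) (sym (+-identityʳ j)) , 2a+1≡ , x≡)

pronic-excess : ∀ a m q → 0 < q → suc m * m ≡ a * (a + 1) + q
              → ∃[ x ] (m ≡ a + x × x * (x + (2 * a + 1)) ≡ q)
pronic-excess a m q 0<q eq with ≤-total a m
... | inj₁ a≤m with m≤n⇒∃[o]m+o≡n a≤m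
...   | x , refl = x , refl , +-cancelˡ-≡ (a * (a + 1)) _ _ (trans (expand a x) eq)
  where expand : ∀ a x → a * (a + 1) + x * (x + (2 * a + 1)) ≡ suc (a + x) * (a + x)
        expand = solve-∀
pronic-excess a m q 0<q eq | inj₂ m≤a = contradiction eq (<⇒≢ [1+m]*m<a*[a+1]+q)
  where
  [1+m]*m<a*[a+1]+q : suc m * m < a * (a + 1) + q
  [1+m]*m<a*[a+1]+q = begin-strict
    suc m * m         ≤⟨ *-mono-≤ (s≤s m≤a) m≤a ⟩
    suc a * a         ≡⟨ [1+a]*a≡a*[a+1] a ⟩
    a * (a + 1)       <⟨ m<m+n (a * (a + 1)) 0<q ⟩
    a * (a + 1) + q   ∎
    where open ≤-Reasoning

m⊖n≡+o⇒m≡n+o : ∀ m n {o} → m ⊖ n ≡ + o → m ≡ n + o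
m⊖n≡+o⇒m≡n+o m zero refl = refl
m⊖n≡+o⇒m≡n+o (suc m) (suc n) eq = cong suc (m⊖n≡+o⇒m≡n+o m n (trans (sym ([1+m]⊖[1+n]≡m⊖n m n)) eq))

+[n+1+d]-+[n+1]≡+d : ∀ n d → + (n + suc d) - + (n + 1) ≡ + d
+[n+1+d]-+[n+1]≡+d n d = trans ([+m]-[+n]≡m⊖n (n + suc d) (n + 1)) (+-cancelˡ-⊖ n (suc d) 1)

+[m+n]-+m≡+n : ∀ m n → + (m + n) - + m ≡ + n
+[m+n]-+m≡+n m n = trans ([+m]-[+n]≡m⊖n (m + n) m) (trans (⊖-≥ (m≤m+n m n)) (cong +_ (m+n∸m≡n m n)))

PrimePowerCases : ℕ → ℕ → ℕ → ℕ → ℕ → Set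
PrimePowerCases n r a p e =
  (∃[ i ] (e ≡ 2 * i × 8 * n + 1 ≡ p ^ e × 1 < n × 2 * a + 1 ≡ p ^ i × 2 * r ≡ 3 * p ^ i + 1))
  ⊎ (p ^ e ≡ 7 × n ≡ 3 × a ≡ 2 × r ≡ 5)

solution⇒cases : ∀ n m a x p e → 2 ≤ n → 2 * n ≡ a * (a + 1) → m ≡ a + x
               → (∃[ i ] (e ≡ 2 * i × 2 * a + 1 ≡ p ^ i × x ≡ p ^ i)) ⊎ (a ≡ 2 × x ≡ 2 × p ^ e ≡ 7)
               → PrimePowerCases n (suc m) a p e
solution⇒cases n m a x p e 2≤n 2n≡ refl (inj₁ (i , refl , 2a+1≡ , refl)) =
  inj₁ (i , refl , 8n+1≡ , 2≤n , 2a+1≡ , 2r≡)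
  where
  open ≡-Reasoning
  8n+1≡ : 8 * n + 1 ≡ p ^ (2 * i)
  8n+1≡ = begin
    8 * n + 1                    ≡⟨ expand n ⟩
    suc (4 * (2 * n))            ≡⟨ cong (λ z → suc (4 * z)) 2n≡ ⟩
    suc (4 * (a * (a + 1)))      ≡⟨ sym ([2a+1]²≡1+4a[a+1] a) ⟩
    (2 * a + 1) * (2 * a + 1)    ≡⟨ cong (λ z → z * z) 2a+1≡ ⟩
    p ^ i * p ^ i                ≡⟨ sym (^-distribˡ-+-* p i i) ⟩
    p ^ (i + i)                  ≡⟨ cong (λ z → p ^ (i + z)) (sym (+-identityʳ i)) ⟩
    p ^ (2 * i)                  ∎
    where expand : ∀ n → 8 * n + 1 ≡ suc (4 * (2 * n))
          expand = solve-∀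
  2r≡ : 2 * suc (a + p ^ i) ≡ 3 * p ^ i + 1
  2r≡ = begin
    2 * suc (a + p ^ i)          ≡⟨ cong (λ z → 2 * suc (a + z)) (sym 2a+1≡) ⟩
    2 * suc (a + (2 * a + 1))    ≡⟨ expand a ⟩
    3 * (2 * a + 1) + 1          ≡⟨ cong (λ z → 3 * z + 1) 2a+1≡ ⟩
    3 * p ^ i + 1                ∎
    where expand : ∀ a → 2 * suc (a + (2 * a + 1)) ≡ 3 * (2 * a + 1) + 1
          expand = solve-∀
solution⇒cases n m a x p e _ 2n≡ refl (inj₂ (refl , refl , p^e≡7)) =
  inj₂ (p^e≡7 , *-cancelˡ-≡ n 3 2 2n≡ , refl , refl)

cases⇒fC≡p^e : ∀ n m a p e → 2 * n ≡ a * (a + 1) → PrimePowerCases n (suc m) a p e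
             → fC n (suc m) ≡ + (p ^ e)
cases⇒fC≡p^e n m a p e 2n≡ (inj₁ (i , _ , 8n+1≡ , _ , 2a+1≡ , 2r≡)) =
  subst (λ t → + t - + n ≡ + (p ^ e)) (sym T≡) (+[m+n]-+m≡+n n (p ^ e))
  where
  open ≡-Reasoning
  m≡ : m ≡ 3 * a + 1
  m≡ = suc-injective (*-cancelˡ-≡ _ _ 2 (trans 2r≡ (trans (cong (λ z → 3 * z + 1) (sym 2a+1≡)) (expand a))))
    where expand : ∀ a → 3 * (2 * a + 1) + 1 ≡ 2 * suc (3 * a + 1)
          expand = solve-∀
  T≡ : T (suc m) ≡ n + p ^ e
  T≡ = *-cancelʳ-≡ _ _ 2 (begin
    T (suc m) * 2                  ≡⟨ T[1+m]*2≡[1+m]*m m ⟩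
    suc m * m                      ≡⟨ cong (λ z → suc z * z) m≡ ⟩
    suc (3 * a + 1) * (3 * a + 1)  ≡⟨ expand₁ a ⟩
    9 * (a * (a + 1)) + 2          ≡⟨ cong (λ z → 9 * z + 2) (sym 2n≡) ⟩
    9 * (2 * n) + 2                ≡⟨ expand₂ n ⟩
    (n + (8 * n + 1)) * 2          ≡⟨ cong (λ z → (n + z) * 2) 8n+1≡ ⟩
    (n + p ^ e) * 2                ∎)
    where expand₁ : ∀ a → suc (3 * a + 1) * (3 * a + 1) ≡ 9 * (a * (a + 1)) + 2
          expand₁ = solve-∀
          expand₂ : ∀ n → 9 * (2 * n) + 2 ≡ (n + (8 * n + 1)) * 2
          expand₂ = solve-∀
cases⇒fC≡p^e n m a p e _ (inj₂ (p^e≡7 , refl , _ , refl)) = cong +_ (sym p^e≡7)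

fC≡p^e⇒cases : ∀ n m a p e → 2 ≤ n → + (2 * n) ∣ + T (suc m) - + (n + 1) → 2 * n ≡ a * (a + 1)
             → Prime p → 1 ≤ e → fC n (suc m) ≡ + (p ^ e) → p % 2 ≡ 1 × PrimePowerCases n (suc m) a p e
fC≡p^e⇒cases n m a p (suc e) 2≤n 2n∣ 2n≡ p-prime _ fC≡p^e =
  let x , m≡a+x , x-equation = pronic-excess a m (2 * p ^ suc e) 0<2p^e [1+m]*m≡
  in  p-odd , solution⇒cases n m a x p (suc e) 2≤n 2n≡ m≡a+x
                (solutions-of-x[x+2a+1]≡2p^e p-prime a (suc e) x D 2≤a x-equation p^e≡1+D a[a+1]∣D)
  where
  instance
    p≢0 : NonZero p
    p≢0 = prime⇒nonZero p-prime
    p^e≢0 : NonZero (p ^ suc e)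
    p^e≢0 = m^n≢0 p (suc e)
  D : ℕ
  D = pred (p ^ suc e)
  p^e≡1+D : p ^ suc e ≡ suc D
  p^e≡1+D = sym (suc-pred (p ^ suc e))
  0<2p^e : 0 < 2 * p ^ suc e
  0<2p^e = *-monoʳ-< 2 (m^n>0 p (suc e))
  2≤a : 2 ≤ a
  2≤a = 2*n≡a*[a+1]⇒2≤a n a 2≤n 2n≡
  T≡ : T (suc m) ≡ n + p ^ suc e
  T≡ = m⊖n≡+o⇒m≡n+o (T (suc m)) n (trans (sym ([+m]-[+n]≡m⊖n (T (suc m)) n)) fC≡p^e)
  a[a+1]∣D : a * (a + 1) ℕ.∣ D
  a[a+1]∣D = subst₂ ℕ._∣_ 2n≡ ∣+[n+p^e]-+[n+1]∣≡D (subst (λ t → 2 * n ℕ.∣ ∣ + t - + (n + 1) ∣) T≡ 2n∣)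
    where ∣+[n+p^e]-+[n+1]∣≡D : ∣ + (n + p ^ suc e) - + (n + 1) ∣ ≡ D
          ∣+[n+p^e]-+[n+1]∣≡D =
            cong ∣_∣ (trans (cong (λ t → + (n + t) - + (n + 1)) p^e≡1+D) (+[n+1+d]-+[n+1]≡+d n D))
  p-odd : p % 2 ≡ 1
  p-odd = ^≡1+even⇒odd p e D (∣-trans (2∣a*[a+1] a) a[a+1]∣D) p^e≡1+D
  [1+m]*m≡ : suc m * m ≡ a * (a + 1) + 2 * p ^ suc e
  [1+m]*m≡ = begin
    suc m * m                        ≡⟨ sym (T[1+m]*2≡[1+m]*m m) ⟩
    T (suc m) * 2                    ≡⟨ cong (_* 2) T≡ ⟩
    (n + p ^ suc e) * 2              ≡⟨ expand n (p ^ suc e) ⟩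
    2 * n + 2 * p ^ suc e            ≡⟨ cong (_+ 2 * p ^ suc e) 2n≡ ⟩
    a * (a + 1) + 2 * p ^ suc e      ∎
    where open ≡-Reasoning
          expand : ∀ n q → (n + q) * 2 ≡ 2 * n + 2 * q
          expand = solve-∀

mainTheorem4 : (n r : ℕ) → 2 ≤ n → 1 ≤ r → r < 4 * n
    → (+ (2 * n)) ∣ (+ T r - + (n + 1))
    → Reducible-f n r
    → (a : ℕ) → 1 ≤ a → 2 * n ≡ a * (a + 1)
    → (p e : ℕ) → Prime p → 1 ≤ e
    → (fC n r ≡ + (p ^ e))
      ⇔ (p % 2 ≡ 1
         × ((∃[ i ] (e ≡ 2 * i × 8 * n + 1 ≡ p ^ e × 1 < n
                     × 2 * a + 1 ≡ p ^ i × 2 * r ≡ 3 * p ^ i + 1))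
            ⊎ (p ^ e ≡ 7 × n ≡ 3 × a ≡ 2 × r ≡ 5)))
mainTheorem4 n (suc m) 2≤n _ _ 2n∣ _ a _ 2n≡ p e p-prime 1≤e =
  mk⇔ (fC≡p^e⇒cases n m a p e 2≤n 2n∣ 2n≡ p-prime 1≤e) (cases⇒fC≡p^e n m a p e 2n≡ ∘ proj₂)
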